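{- Let $p$ be a prime, $\{a^1,\ldots,a^n\}\subseteq \mathbb{Z}^m$, and $C:=\operatorname{cone}\{a^1,\ldots,a^n\}$. Then $\{a^1,\ldots,a^n\}$ is a $p$-adic generating set for a cone if and only if, for every nonempty face $F$ of $C$, the set $\{a^i: a^i\in F\}$ is a $p$-adic generating set for a subspace.
   Context: A $p$-adic rational is a number of the form $a/p^k$ with $a,k$ integers and $k\geq 0$. A finite set $S\subseteq\mathbb{Z}^m$ is a $p$-adic generating set for a cone if every integral vector in the conic hull of $S$ can be written as a conic combination of the vectors of $S$ with $p$-adic nonnegative coefficients; it is a $p$-adic generating set for a subspace if every integral vector in the linear span of $S$ can be written as a linear combination of the vectors of $S$ with $p$-adic coefficients.
   Formalization: The conic hull and the linear span use rational coefficients, and the faces of C are cut out by supporting hyperplanes with rational normal vectors. -}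

module Defs where

open import Data.Nat using (ℕ; zero; suc; _^_; NonZero)
open import Data.Integer using (ℤ)
open import Data.Rational using (ℚ; _+_; _*_; _≤_; 0ℚ; _/_)

open import Data.Fin using (Fin)
import Data.Fin as Fin
open import Data.Product using (Σ; ∃; ∃-syntax; _×_)
open import Relation.Binary.PropositionalEquality using (_≡_)
open import Relation.Nullary using (¬_)

∑ : ∀ {n} → (Fin n → ℚ) → ℚ
∑ {zero}  f = 0ℚ
∑ {suc n} f = f Fin.zero + ∑ (λ i → f (Fin.suc i))

Vecℚ : ℕ → Set
Vecℚ m = Fin m → ℚ

Vecℤ : ℕ → Set
Vecℤ m = Fin m → ℤ

embed : ∀ {m} → Vecℤ m → Vecℚ m
embed x j = x j / 1

_·_ : ∀ {m} → Vecℚ m → Vecℚ m → ℚ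
w · x = ∑ (λ j → w j * x j)

comb : ∀ {n m} → (Fin n → Vecℤ m) → (Fin n → ℚ) → Vecℚ m
comb a λ′ j = ∑ (λ i → λ′ i * (a i j / 1))

IsPAdic : ℕ → ℚ → Set
IsPAdic p q = ∃[ k ] ∃[ a ] Σ (NonZero (p ^ k)) (λ nz → q ≡ _/_ a (p ^ k) {{nz}})

InCone : ∀ {n m} → (Fin n → Vecℤ m) → Vecℚ m → Set
InCone a x = ∃[ λ′ ] ((∀ i → 0ℚ ≤ λ′ i) × (∀ j → comb a λ′ j ≡ x j))

InSpan : ∀ {n m} → (Fin n → Vecℤ m) → (Fin n → Set) → Vecℚ m → Set
InSpan a S x = ∃[ λ′ ] ((∀ i → ¬ S i → λ′ i ≡ 0ℚ) × (∀ j → comb a λ′ j ≡ x j))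

PAdicGenCone : ∀ {n m} → ℕ → (Fin n → Vecℤ m) → Set
PAdicGenCone {n} {m} p a =
  (x : Vecℤ m) → InCone a (embed x) →
  ∃[ λ′ ] ((∀ i → 0ℚ ≤ λ′ i × IsPAdic p (λ′ i)) × (∀ j → comb a λ′ j ≡ embed x j))

PAdicGenSpan : ∀ {n m} → ℕ → (Fin n → Vecℤ m) → (Fin n → Set) → Set
PAdicGenSpan {n} {m} p a S =
  (x : Vecℤ m) → InSpan a S (embed x) →
  ∃[ λ′ ] ((∀ i → ¬ S i → λ′ i ≡ 0ℚ) × (∀ i → IsPAdic p (λ′ i)) × (∀ j → comb a λ′ j ≡ embed x j))

-- faces of C = cone{a^i}: F_w = {x ∈ C : w·x = 0} for a valid inequality w·x ≥ 0 on C
ValidIneq : ∀ {n m} → (Fin n → Vecℤ m) → Vecℚ m → Set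
ValidIneq {n} {m} a w = (x : Vecℚ m) → InCone a x → 0ℚ ≤ w · x

InFace : ∀ {n m} → (Fin n → Vecℤ m) → Vecℚ m → Vecℚ m → Set
InFace a w x = InCone a x × (w · x ≡ 0ℚ)

{-# OPTIONS --safe #-}
-- (⇒) Let x be an integral point of span F for a face F, written with rational coefficients supported
-- on F. Adding N aⁱ for every aⁱ ∈ F, with N large, gives an integral point y of the cone with a
-- nonnegative representation; hence y has a nonnegative p-adic representation, which is supported on
-- F because F is a face. Subtracting the integral shift again represents x p-adically on F.
--
-- (⇐) Let x be an integral point of the cone. Farkas' lemma yields the minimal face F containing x and
-- a representation x = Σ νᵢ aⁱ with νᵢ ≥ 0 and νᵢ > 0 exactly on F. The face hypothesis gives a p-adic
-- representation x = Σ λᵢ aⁱ supported on F. If D clears the denominators of ν, choose p-adic γ ≥ 0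
-- so small that γ λ + (1 - γ) ν ≥ 0 and with 1 - γ ∈ D ℤ[1/p]; then
-- γ λ + (1 - γ) ν is a nonnegative p-adic representation of x.

module Submission where

open import Defs
open import Algebra.Bundles using (CommutativeRing)
import Algebra.Properties.Semiring.Sum as SemiringSum
open import Data.Empty using (⊥-elim)
open import Data.Fin using (Fin; zero; suc)
import Data.Fin.Properties
open import Data.Fin.Properties using (¬∀⟶∃¬)
import Data.Integer as ℤ
open import Data.Integer using (ℤ)
import Data.Integer.Properties as ℤ
import Data.Nat as ℕ
open import Data.Nat using (ℕ; NonZero)
import Data.Nat.DivMod as ℕ
import Data.Nat.Properties as ℕ
open import Data.Nat.Primality using (Prime; prime⇒nonTrivial)
open import Data.Product using (Σ; ∃; _×_; _,_; proj₁; proj₂; map₂)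
open import Data.Rational
  using (ℚ; mkℚ; _+_; _*_; _-_; -_; _≤_; _<_; 0ℚ; 1ℚ; _/_; 1/_; ↥_; ↧ₙ_)
open import Data.Rational.Base using (positive; negative; nonNegative; ≢-nonZero)
import Data.Rational as ℚ
open import Data.Rational.Properties
open import Algebra.Properties.Ring (CommutativeRing.ring +-*-commutativeRing) using (-1*x≈-x; -‿involutive)
open import Data.Rational.Solver using (module +-*-Solver)
import Data.Rational.Unnormalised as ℚᵘ
import Data.Rational.Unnormalised.Properties as ℚᵘ
open import Data.Sum using (_⊎_; inj₁; inj₂)
open import Function using (_∘_)
open import Function.Bundles using (_⇔_; mk⇔)
open import Relation.Binary using (tri<; tri≈; tri>)
open import Relation.Binary.PropositionalEquality
  using (_≡_; _≢_; refl; sym; trans; cong; cong₂; subst; subst₂; module ≡-Reasoning)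
open import Relation.Nullary using (¬_; Dec; yes; no; does)
open import Relation.Nullary.Decidable using (dec-true; dec-false)
open import Data.Bool using (if_then_else_)

open +-*-Solver using (solve; _:+_; _:*_; :-_; _:=_; con)
module Sum = SemiringSum (CommutativeRing.semiring +-*-commutativeRing)
module ℤSum = SemiringSum ℤ.+-*-semiring

∑≡sum : ∀ {n} (f : Fin n → ℚ) → ∑ f ≡ Sum.sum f
∑≡sum {ℕ.zero}  f = refl
∑≡sum {ℕ.suc n} f = cong (f zero +_) (∑≡sum (f ∘ suc))

∑-cong : ∀ {n} {f g : Fin n → ℚ} → (∀ i → f i ≡ g i) → ∑ f ≡ ∑ g
∑-cong {f = f} {g} f≗g = trans (∑≡sum f) (trans (Sum.sum-cong-≗ f≗g) (sym (∑≡sum g)))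

∑-distrib-+ : ∀ {n} (f g : Fin n → ℚ) → ∑ (λ i → f i + g i) ≡ ∑ f + ∑ g
∑-distrib-+ f g = begin
  ∑ (λ i → f i + g i)      ≡⟨ ∑≡sum (λ i → f i + g i) ⟩
  Sum.sum (λ i → f i + g i) ≡⟨ Sum.∑-distrib-+ f g ⟩
  Sum.sum f + Sum.sum g     ≡⟨ sym (cong₂ _+_ (∑≡sum f) (∑≡sum g)) ⟩
  ∑ f + ∑ g                 ∎
  where open ≡-Reasoning

*-distribˡ-∑ : ∀ {n} (c : ℚ) (f : Fin n → ℚ) → c * ∑ f ≡ ∑ (λ i → c * f i)
*-distribˡ-∑ c f = begin
  c * ∑ f               ≡⟨ cong (c *_) (∑≡sum f) ⟩
  c * Sum.sum f         ≡⟨ Sum.*-distribˡ-sum c f ⟩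
  Sum.sum (λ i → c * f i) ≡⟨ sym (∑≡sum (λ i → c * f i)) ⟩
  ∑ (λ i → c * f i)     ∎
  where open ≡-Reasoning

∑-zero : ∀ n → ∑ {n} (λ _ → 0ℚ) ≡ 0ℚ
∑-zero n = trans (∑≡sum {n} (λ _ → 0ℚ)) (Sum.sum-replicate-zero n)

∑-comm : ∀ {n m} (f : Fin n → Fin m → ℚ) → ∑ (λ i → ∑ (f i)) ≡ ∑ (λ j → ∑ (λ i → f i j))
∑-comm f = begin
  ∑ (λ i → ∑ (f i))                   ≡⟨ ∑-cong (λ i → ∑≡sum (f i)) ⟩
  ∑ (λ i → Sum.sum (f i))             ≡⟨ ∑≡sum (λ i → Sum.sum (f i)) ⟩
  Sum.sum (λ i → Sum.sum (f i))       ≡⟨ Sum.∑-comm f ⟩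
  Sum.sum (λ j → Sum.sum (λ i → f i j)) ≡⟨ sym (∑≡sum (λ j → Sum.sum (λ i → f i j))) ⟩
  ∑ (λ j → Sum.sum (λ i → f i j))     ≡⟨ ∑-cong (λ j → sym (∑≡sum (λ i → f i j))) ⟩
  ∑ (λ j → ∑ (λ i → f i j))           ∎
  where open ≡-Reasoning

∑-neg : ∀ {n} (f : Fin n → ℚ) → ∑ (λ i → - f i) ≡ - ∑ f
∑-neg f = begin
  ∑ (λ i → - f i)         ≡⟨ ∑-cong (λ i → sym (-1*x≈-x (f i))) ⟩
  ∑ (λ i → - 1ℚ * f i)    ≡⟨ sym (*-distribˡ-∑ (- 1ℚ) f) ⟩
  - 1ℚ * ∑ f              ≡⟨ -1*x≈-x (∑ f) ⟩
  - ∑ f                   ∎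
  where open ≡-Reasoning

∑-nonNeg : ∀ {n} (f : Fin n → ℚ) → (∀ i → 0ℚ ≤ f i) → 0ℚ ≤ ∑ f
∑-nonNeg {ℕ.zero}  f 0≤f = ≤-refl
∑-nonNeg {ℕ.suc n} f 0≤f = +-mono-≤ (0≤f zero) (∑-nonNeg (f ∘ suc) (0≤f ∘ suc))

term≤∑ : ∀ {n} (f : Fin n → ℚ) → (∀ i → 0ℚ ≤ f i) → ∀ i → f i ≤ ∑ f
term≤∑ {ℕ.suc n} f 0≤f zero =
  ≤-trans (≤-reflexive (sym (+-identityʳ (f zero)))) (+-monoʳ-≤ (f zero) (∑-nonNeg (f ∘ suc) (0≤f ∘ suc)))
term≤∑ {ℕ.suc n} f 0≤f (suc i) =
  ≤-trans (≤-reflexive (sym (+-identityˡ (f (suc i))))) (+-mono-≤ (0≤f zero) (term≤∑ (f ∘ suc) (0≤f ∘ suc) i))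

∑-nonNeg-≡0 : ∀ {n} (f : Fin n → ℚ) → (∀ i → 0ℚ ≤ f i) → ∑ f ≡ 0ℚ → ∀ i → f i ≡ 0ℚ
∑-nonNeg-≡0 f 0≤f ∑f≡0 i = ≤-antisym (≤-trans (term≤∑ f 0≤f i) (≤-reflexive ∑f≡0)) (0≤f i)

*-nonNeg : ∀ {p q} → 0ℚ ≤ p → 0ℚ ≤ q → 0ℚ ≤ p * q
*-nonNeg {p} {q} 0≤p 0≤q = nonNegative⁻¹ (p * q) {{nonNeg*nonNeg⇒nonNeg p {{nonNegative 0≤p}} q {{nonNegative 0≤q}}}}

*-pos : ∀ {p q} → 0ℚ < p → 0ℚ < q → 0ℚ < p * q
*-pos {p} {q} 0<p 0<q = positive⁻¹ (p * q) {{pos*pos⇒pos p {{positive 0<p}} q {{positive 0<q}}}}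

0<x*x : ∀ x → x ≢ 0ℚ → 0ℚ < x * x
0<x*x x x≢0 with <-cmp x 0ℚ
... | tri< x<0 _ _ = positive⁻¹ (x * x) {{neg*neg⇒pos x {{negative x<0}} x {{negative x<0}}}}
... | tri≈ _ x≡0 _ = ⊥-elim (x≢0 x≡0)
... | tri> _ _ 0<x = *-pos 0<x 0<x

0≤x*x : ∀ x → 0ℚ ≤ x * x
0≤x*x x with x ≟ 0ℚ
... | yes refl = ≤-refl
... | no x≢0 = <⇒≤ (0<x*x x x≢0)

*-cancelˡ-≡ : ∀ c {x y} .{{_ : ℚ.NonZero c}} → c * x ≡ c * y → x ≡ y
*-cancelˡ-≡ c {x} {y} cx≡cy = begin
  x                 ≡⟨ sym (*-identityˡ x) ⟩
  1ℚ * x            ≡⟨ cong (_* x) (sym (*-inverseˡ c)) ⟩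
  1/ c * c * x      ≡⟨ *-assoc (1/ c) c x ⟩
  1/ c * (c * x)    ≡⟨ cong (1/ c *_) cx≡cy ⟩
  1/ c * (c * y)    ≡⟨ sym (*-assoc (1/ c) c y) ⟩
  1/ c * c * y      ≡⟨ cong (_* y) (*-inverseˡ c) ⟩
  1ℚ * y            ≡⟨ *-identityˡ y ⟩
  y                 ∎
  where open ≡-Reasoning

x*y≡0⇒x≡0 : ∀ {x y} → x * y ≡ 0ℚ → y ≢ 0ℚ → x ≡ 0ℚ
x*y≡0⇒x≡0 {x} {y} xy≡0 y≢0 =
  *-cancelˡ-≡ y {{≢-nonZero y≢0}} (trans (*-comm y x) (trans xy≡0 (sym (*-zeroʳ y))))

0<1 : 0ℚ < 1ℚ
0<1 = positive⁻¹ 1ℚ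

lin : ∀ {n m} → (Fin n → Vecℚ m) → (Fin n → ℚ) → Vecℚ m
lin g μ k = ∑ (λ i → μ i * g i k)

lin-+ : ∀ {n m} (g : Fin n → Vecℚ m) (μ ν : Fin n → ℚ) → ∀ k → lin g (λ i → μ i + ν i) k ≡ lin g μ k + lin g ν k
lin-+ g μ ν k = trans (∑-cong (λ i → *-distribʳ-+ (g i k) (μ i) (ν i))) (∑-distrib-+ (λ i → μ i * g i k) (λ i → ν i * g i k))

lin-* : ∀ {n m} (g : Fin n → Vecℚ m) (c : ℚ) (μ : Fin n → ℚ) → ∀ k → lin g (λ i → c * μ i) k ≡ c * lin g μ k
lin-* g c μ k = trans (∑-cong (λ i → *-assoc c (μ i) (g i k))) (sym (*-distribˡ-∑ c (λ i → μ i * g i k)))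

·-cong : ∀ {m} (w : Vecℚ m) {x y : Vecℚ m} → (∀ k → x k ≡ y k) → w · x ≡ w · y
·-cong w x≗y = ∑-cong (λ k → cong (w k *_) (x≗y k))

·-lin : ∀ {n m} (w : Vecℚ m) (g : Fin n → Vecℚ m) (μ : Fin n → ℚ) → w · lin g μ ≡ ∑ (λ i → μ i * (w · g i))
·-lin w g μ = begin
  ∑ (λ k → w k * ∑ (λ i → μ i * g i k))    ≡⟨ ∑-cong (λ k → *-distribˡ-∑ (w k) (λ i → μ i * g i k)) ⟩
  ∑ (λ k → ∑ (λ i → w k * (μ i * g i k)))  ≡⟨ ∑-comm (λ k i → w k * (μ i * g i k)) ⟩
  ∑ (λ i → ∑ (λ k → w k * (μ i * g i k)))  ≡⟨ ∑-cong (λ i → ∑-cong (λ k → swap-* (w k) (μ i) (g i k))) ⟩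
  ∑ (λ i → ∑ (λ k → μ i * (w k * g i k)))  ≡⟨ ∑-cong (λ i → sym (*-distribˡ-∑ (μ i) (λ k → w k * g i k))) ⟩
  ∑ (λ i → μ i * (w · g i))                ∎
  where
  open ≡-Reasoning
  swap-* : ∀ a b c → a * (b * c) ≡ b * (a * c)
  swap-* = solve 3 (λ a b c → a :* (b :* c) := b :* (a :* c)) refl

lin₂ : ∀ {m} → ℚ → Vecℚ m → ℚ → Vecℚ m → Vecℚ m
lin₂ α u β v k = α * u k + β * v k

lin₂-· : ∀ {m} (α β : ℚ) (u v x : Vecℚ m) → lin₂ α u β v · x ≡ α * (u · x) + β * (v · x)
lin₂-· α β u v x = begin
  ∑ (λ k → (α * u k + β * v k) * x k)                 ≡⟨ ∑-cong (λ k → distrib (u k) (v k) (x k)) ⟩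
  ∑ (λ k → α * (u k * x k) + β * (v k * x k))         ≡⟨ ∑-distrib-+ (λ k → α * (u k * x k)) (λ k → β * (v k * x k)) ⟩
  ∑ (λ k → α * (u k * x k)) + ∑ (λ k → β * (v k * x k)) ≡⟨ sym (cong₂ _+_ (*-distribˡ-∑ α (λ k → u k * x k)) (*-distribˡ-∑ β (λ k → v k * x k))) ⟩
  α * (u · x) + β * (v · x)                           ∎
  where
  open ≡-Reasoning
  distrib : ∀ u v x → (α * u + β * v) * x ≡ α * (u * x) + β * (v * x)
  distrib = solve 5 (λ α β u v x → (α :* u :+ β :* v) :* x := α :* (u :* x) :+ β :* (v :* x)) refl α β

·-lin₂ : ∀ {m} (α β : ℚ) (w x y : Vecℚ m) → w · lin₂ α x β y ≡ α * (w · x) + β * (w · y)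
·-lin₂ α β w x y = begin
  ∑ (λ k → w k * (α * x k + β * y k))                 ≡⟨ ∑-cong (λ k → distrib (w k) (x k) (y k)) ⟩
  ∑ (λ k → α * (w k * x k) + β * (w k * y k))         ≡⟨ ∑-distrib-+ (λ k → α * (w k * x k)) (λ k → β * (w k * y k)) ⟩
  ∑ (λ k → α * (w k * x k)) + ∑ (λ k → β * (w k * y k)) ≡⟨ sym (cong₂ _+_ (*-distribˡ-∑ α (λ k → w k * x k)) (*-distribˡ-∑ β (λ k → w k * y k))) ⟩
  α * (w · x) + β * (w · y)                           ∎
  where
  open ≡-Reasoning
  distrib : ∀ w x y → w * (α * x + β * y) ≡ α * (w * x) + β * (w * y)
  distrib = solve 5 (λ α β w x y → w :* (α :* x :+ β :* y) := α :* (w :* x) :+ β :* (w :* y)) refl α β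

·-neg : ∀ {m} (w x : Vecℚ m) → w · (λ k → - x k) ≡ - (w · x)
·-neg w x = trans (∑-cong (λ k → sym (neg-distribʳ-* (w k) (x k)))) (∑-neg (λ k → w k * x k))

δ : ∀ {n} → Fin n → Fin n → ℚ
δ zero    zero    = 1ℚ
δ zero    (suc i) = 0ℚ
δ (suc j) zero    = 0ℚ
δ (suc j) (suc i) = δ j i

0≤δ : ∀ {n} (j i : Fin n) → 0ℚ ≤ δ j i
0≤δ zero    zero    = <⇒≤ 0<1
0≤δ zero    (suc i) = ≤-refl
0≤δ (suc j) zero    = ≤-refl
0≤δ (suc j) (suc i) = 0≤δ j i

δ-diag : ∀ {n} (j : Fin n) → δ j j ≡ 1ℚ
δ-diag zero    = refl
δ-diag (suc j) = δ-diag j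

∑-δ : ∀ {n} (j : Fin n) (f : Fin n → ℚ) → ∑ (λ i → δ j i * f i) ≡ f j
∑-δ {ℕ.suc n} zero f = begin
  1ℚ * f zero + ∑ (λ i → 0ℚ * f (suc i)) ≡⟨ cong₂ _+_ (*-identityˡ (f zero)) (trans (∑-cong (λ i → *-zeroˡ (f (suc i)))) (∑-zero n)) ⟩
  f zero + 0ℚ                            ≡⟨ +-identityʳ (f zero) ⟩
  f zero                                 ∎
  where open ≡-Reasoning
∑-δ {ℕ.suc n} (suc j) f = trans (cong₂ _+_ (*-zeroˡ (f zero)) (∑-δ j (f ∘ suc))) (+-identityˡ (f (suc j)))

+-· : ∀ {m} (u v x : Vecℚ m) → (λ k → u k + v k) · x ≡ u · x + v · x
+-· u v x = trans (∑-cong (λ k → *-distribʳ-+ (x k) (u k) (v k))) (∑-distrib-+ (λ k → u k * x k) (λ k → v k * x k))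

lin-neg : ∀ {n m} (g : Fin n → Vecℚ m) (μ : Fin n → ℚ) → ∀ k → lin g (λ i → - μ i) k ≡ - lin g μ k
lin-neg g μ k = trans (∑-cong (λ i → sym (neg-distribˡ-* (μ i) (g i k)))) (∑-neg (λ i → μ i * g i k))

lin-affine : ∀ {n m} (g : Fin n → Vecℚ m) (γ : ℚ) (μ ν : Fin n → ℚ) {x : Vecℚ m} →
  (∀ k → lin g μ k ≡ x k) → (∀ k → lin g ν k ≡ x k) → ∀ k → lin g (λ i → γ * μ i + (1ℚ - γ) * ν i) k ≡ x k
lin-affine g γ μ ν {x} μ-rep ν-rep k = begin
  lin g (λ i → γ * μ i + (1ℚ - γ) * ν i) k         ≡⟨ lin-+ g (λ i → γ * μ i) (λ i → (1ℚ - γ) * ν i) k ⟩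
  lin g (λ i → γ * μ i) k + lin g (λ i → (1ℚ - γ) * ν i) k ≡⟨ cong₂ _+_ (lin-* g γ μ k) (lin-* g (1ℚ - γ) ν k) ⟩
  γ * lin g μ k + (1ℚ - γ) * lin g ν k             ≡⟨ cong₂ (λ s t → γ * s + (1ℚ - γ) * t) (μ-rep k) (ν-rep k) ⟩
  γ * x k + (1ℚ - γ) * x k                         ≡⟨ solve 2 (λ γ x → γ :* x :+ (con 1ℚ :+ :- γ) :* x := x) refl γ (x k) ⟩
  x k                                              ∎
  where open ≡-Reasoning

-- Cones and Farkas' lemma

Conic : ∀ {n m} → (Fin n → Vecℚ m) → Vecℚ m → Set
Conic g b = ∃ λ μ → (∀ i → 0ℚ ≤ μ i) × (∀ k → lin g μ k ≡ b k)

Separable : ∀ {n m} → (Fin n → Vecℚ m) → Vecℚ m → Set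
Separable g b = ∃ λ w → (∀ i → 0ℚ ≤ w · g i) × (w · b < 0ℚ)

valid-conic-nonNeg : ∀ {n m} (g : Fin n → Vecℚ m) (w : Vecℚ m) {x : Vecℚ m} → (∀ i → 0ℚ ≤ w · g i) → Conic g x → 0ℚ ≤ w · x
valid-conic-nonNeg g w w-valid (μ , 0≤μ , μ-rep) =
  subst (0ℚ ≤_) (trans (sym (·-lin w g μ)) (·-cong w μ-rep)) (∑-nonNeg _ (λ i → *-nonNeg (0≤μ i) (w-valid i)))

support⊆face : ∀ {n m} (g : Fin n → Vecℚ m) (w : Vecℚ m) {x : Vecℚ m} {μ : Fin n → ℚ} →
  (∀ i → 0ℚ ≤ w · g i) → (∀ i → 0ℚ ≤ μ i) → (∀ k → lin g μ k ≡ x k) → w · x ≡ 0ℚ →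
  ∀ i → w · g i ≢ 0ℚ → μ i ≡ 0ℚ
support⊆face g w {x} {μ} w-valid 0≤μ μ-rep wx≡0 i wgi≢0 = x*y≡0⇒x≡0 (∑-nonNeg-≡0 _ (λ j → *-nonNeg (0≤μ j) (w-valid j)) ∑≡0 i) wgi≢0
  where
  ∑≡0 : ∑ (λ j → μ j * (w · g j)) ≡ 0ℚ
  ∑≡0 = trans (sym (·-lin w g μ)) (trans (·-cong w μ-rep) wx≡0)

-- One Fourier–Motzkin step: reduce w h v is orthogonal to w, and reduce w h h ≡ 0.
reduce : ∀ {m} → Vecℚ m → Vecℚ m → Vecℚ m → Vecℚ m
reduce w h v = lin₂ (w · h) v (- (w · v)) h

reduce-lin : ∀ {n m} (w h : Vecℚ m) (g : Fin n → Vecℚ m) (μ : Fin n → ℚ) →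
  ∀ k → lin (reduce w h ∘ g) μ k ≡ reduce w h (lin g μ) k
reduce-lin w h g μ k = begin
  ∑ (λ i → μ i * ((w · h) * g i k + - (w · g i) * h k))
    ≡⟨ ∑-cong (λ i → expand (μ i) (g i k) (w · g i)) ⟩
  ∑ (λ i → (w · h) * (μ i * g i k) + h k * - (μ i * (w · g i)))
    ≡⟨ ∑-distrib-+ (λ i → (w · h) * (μ i * g i k)) (λ i → h k * - (μ i * (w · g i))) ⟩
  ∑ (λ i → (w · h) * (μ i * g i k)) + ∑ (λ i → h k * - (μ i * (w · g i)))
    ≡⟨ sym (cong₂ _+_ (*-distribˡ-∑ (w · h) (λ i → μ i * g i k)) (*-distribˡ-∑ (h k) (λ i → - (μ i * (w · g i))))) ⟩
  (w · h) * lin g μ k + h k * ∑ (λ i → - (μ i * (w · g i)))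
    ≡⟨ cong (λ s → (w · h) * lin g μ k + h k * s) (trans (∑-neg (λ i → μ i * (w · g i))) (cong -_ (sym (·-lin w g μ)))) ⟩
  (w · h) * lin g μ k + h k * - (w · lin g μ)
    ≡⟨ cong ((w · h) * lin g μ k +_) (*-comm (h k) _) ⟩
  reduce w h (lin g μ) k ∎
  where
  open ≡-Reasoning
  expand : ∀ m x y → m * ((w · h) * x + - y * h k) ≡ (w · h) * (m * x) + h k * - (m * y)
  expand = solve 5 (λ c hk m x y → m :* (c :* x :+ :- y :* hk) := c :* (m :* x) :+ hk :* (:- (m :* y))) refl (w · h) (h k)

conic-weaken : ∀ {n m} (g : Fin (ℕ.suc n) → Vecℚ m) (b : Vecℚ m) → Conic (g ∘ suc) b → Conic g b
conic-weaken g b (μ , 0≤μ , μ-rep) = μ′ , 0≤μ′ , μ′-rep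
  where
  μ′ : Fin _ → ℚ
  μ′ zero    = 0ℚ
  μ′ (suc i) = μ i
  0≤μ′ : ∀ i → 0ℚ ≤ μ′ i
  0≤μ′ zero    = ≤-refl
  0≤μ′ (suc i) = 0≤μ i
  μ′-rep : ∀ k → 0ℚ * g zero k + lin (g ∘ suc) μ k ≡ b k
  μ′-rep k = trans (cong (_+ lin (g ∘ suc) μ k) (*-zeroˡ (g zero k))) (trans (+-identityˡ _) (μ-rep k))

separable-lift : ∀ {n m} (w : Vecℚ m) (g : Fin (ℕ.suc n) → Vecℚ m) (b : Vecℚ m) →
  Separable (reduce w (g zero) ∘ g ∘ suc) (reduce w (g zero) b) → Separable g b
separable-lift w g b (w′ , w′-valid , w′b<0) = v , v-valid , subst (_< 0ℚ) (sym (v-dual b)) w′b<0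
  where
  h = g zero
  v = lin₂ (w · h) w′ (- (w′ · h)) w

  v-dual : ∀ y → v · y ≡ w′ · reduce w h y
  v-dual y = begin
    v · y                                           ≡⟨ lin₂-· (w · h) (- (w′ · h)) w′ w y ⟩
    (w · h) * (w′ · y) + - (w′ · h) * (w · y)       ≡⟨ solve 4 (λ a b c d → a :* b :+ (:- c) :* d := a :* b :+ (:- d) :* c) refl (w · h) (w′ · y) (w′ · h) (w · y) ⟩
    (w · h) * (w′ · y) + - (w · y) * (w′ · h)       ≡⟨ sym (·-lin₂ (w · h) (- (w · y)) w′ y h) ⟩
    w′ · reduce w h y                               ∎
    where open ≡-Reasoning

  v-valid : ∀ i → 0ℚ ≤ v · g i
  v-valid zero    = ≤-reflexive (sym (begin
    v · h                                     ≡⟨ v-dual h ⟩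
    w′ · reduce w h h                         ≡⟨ ·-lin₂ (w · h) (- (w · h)) w′ h h ⟩
    (w · h) * (w′ · h) + - (w · h) * (w′ · h) ≡⟨ solve 2 (λ a b → a :* b :+ (:- a) :* b := con 0ℚ) refl (w · h) (w′ · h) ⟩
    0ℚ                                        ∎))
    where open ≡-Reasoning
  v-valid (suc i) = subst (0ℚ ≤_) (sym (v-dual (g (suc i)))) (w′-valid i)

conic-lift : ∀ {n m} (w : Vecℚ m) (g : Fin (ℕ.suc n) → Vecℚ m) (b : Vecℚ m) →
  w · g zero < 0ℚ → (∀ i → 0ℚ ≤ w · g (suc i)) → w · b < 0ℚ →
  Conic (reduce w (g zero) ∘ g ∘ suc) (reduce w (g zero) b) → Conic g b
conic-lift w g b wh<0 w-valid wb<0 (μ , 0≤μ , μ-rep) = μ′ , 0≤μ′ , μ′-rep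
  where
  h = g zero
  L = lin (g ∘ suc) μ
  d = - (w · h)
  instance
    d-positive : ℚ.Positive d
    d-positive = positive (neg-antimono-< wh<0)
    d-nonZero : ℚ.NonZero d
    d-nonZero = pos⇒nonZero d

  0≤wL : 0ℚ ≤ w · L
  0≤wL = subst (0ℚ ≤_) (sym (·-lin w (g ∘ suc) μ)) (∑-nonNeg _ (λ i → *-nonNeg (0≤μ i) (w-valid i)))

  κ = (w · L - w · b) * 1/ d

  0≤κ : 0ℚ ≤ κ
  0≤κ = *-nonNeg (+-mono-≤ 0≤wL (<⇒≤ (neg-antimono-< wb<0))) (<⇒≤ (positive⁻¹ (1/ d) {{1/pos⇒pos d}}))

  μ′ : Fin _ → ℚ
  μ′ zero    = κ
  μ′ (suc i) = μ i

  0≤μ′ : ∀ i → 0ℚ ≤ μ′ i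
  0≤μ′ zero    = 0≤κ
  0≤μ′ (suc i) = 0≤μ i

  μ′-rep : ∀ k → κ * h k + L k ≡ b k
  μ′-rep k = *-cancelˡ-≡ d (begin
    d * (κ * h k + L k)
      ≡⟨ solve 6 (λ d i s t h l → d :* ((s :+ :- t) :* i :* h :+ l) := (d :* i) :* ((s :+ :- t) :* h) :+ d :* l) refl d (1/ d) (w · L) (w · b) (h k) (L k) ⟩
    (d * 1/ d) * ((w · L - w · b) * h k) + d * L k
      ≡⟨ cong (λ c → c * ((w · L - w · b) * h k) + d * L k) (*-inverseʳ d) ⟩
    1ℚ * ((w · L - w · b) * h k) + d * L k
      ≡⟨ solve 5 (λ c s t hk l → con 1ℚ :* ((s :+ :- t) :* hk) :+ (:- c) :* l := :- (c :* l :+ (:- s) :* hk) :+ (:- t) :* hk) refl (w · h) (w · L) (w · b) (h k) (L k) ⟩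
    - reduce w h L k + - (w · b) * h k
      ≡⟨ cong (λ z → - z + - (w · b) * h k) (trans (sym (reduce-lin w h (g ∘ suc) μ k)) (μ-rep k)) ⟩
    - reduce w h b k + - (w · b) * h k
      ≡⟨ solve 4 (λ c bk t hk → :- (c :* bk :+ (:- t) :* hk) :+ (:- t) :* hk := (:- c) :* bk) refl (w · h) (b k) (w · b) (h k) ⟩
    d * b k ∎)
    where open ≡-Reasoning

farkas-no-generators : ∀ {m} (g : Fin 0 → Vecℚ m) (b : Vecℚ m) → Conic g b ⊎ Separable g b
farkas-no-generators {m} g b with Data.Fin.Properties.all? (λ k → b k ≟ 0ℚ)
... | yes b≡0 = inj₁ ((λ ()) , (λ ()) , λ k → sym (b≡0 k))
... | no b≢0 = inj₂ ((λ k → - b k) , (λ ()) , -b·b<0)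
  where
  -b·b<0 : (λ k → - b k) · b < 0ℚ
  -b·b<0 with ¬∀⟶∃¬ m (λ k → b k ≡ 0ℚ) (λ k → b k ≟ 0ℚ) b≢0
  ... | k , bk≢0 = subst (_< 0ℚ) (sym (trans (∑-cong (λ j → sym (neg-distribˡ-* (b j) (b j)))) (∑-neg (λ j → b j * b j))))
    (neg-antimono-< (<-≤-trans (0<x*x (b k) bk≢0) (term≤∑ (λ j → b j * b j) (λ j → 0≤x*x (b j)) k)))

farkas : ∀ {m} n (g : Fin n → Vecℚ m) (b : Vecℚ m) → Conic g b ⊎ Separable g b
farkas ℕ.zero g b = farkas-no-generators g b
farkas (ℕ.suc n) g b with farkas n (g ∘ suc) b
... | inj₁ conic = inj₁ (conic-weaken g b conic)
... | inj₂ (w , w-valid , wb<0) with 0ℚ ≤? w · g zero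
...   | yes 0≤wh = inj₂ (w , (λ { zero → 0≤wh ; (suc i) → w-valid i }) , wb<0)
...   | no 0≰wh with farkas n (reduce w (g zero) ∘ g ∘ suc) (reduce w (g zero) b)
...     | inj₁ conic     = inj₁ (conic-lift w g b (≰⇒> 0≰wh) w-valid wb<0 conic)
...     | inj₂ separable = inj₂ (separable-lift w g b separable)

-- Minimal faces

module Certificates {n m} (g : Fin n → Vecℚ m) {x : Vecℚ m} (x-conic : Conic g x) where

  record Certificate : Set where
    field
      normal        : Vecℚ m
      normal-valid  : ∀ i → 0ℚ ≤ normal · g i
      normal-tight  : normal · x ≡ 0ℚ
      coeffs        : Fin n → ℚ
      coeffs-nonNeg : ∀ i → 0ℚ ≤ coeffs i
      coeffs-rep    : ∀ k → lin g coeffs k ≡ x k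

  open Certificate

  Covers : Certificate → Fin n → Set
  Covers c i = 0ℚ < coeffs c i ⊎ 0ℚ < normal c · g i

  ν₀ : Fin n → ℚ
  ν₀ = proj₁ x-conic

  trivial : Certificate
  trivial = record
    { normal = λ _ → 0ℚ ; normal-valid = λ i → ≤-reflexive (sym (0·x≡0 (g i))) ; normal-tight = 0·x≡0 x
    ; coeffs = ν₀ ; coeffs-nonNeg = proj₁ (proj₂ x-conic) ; coeffs-rep = proj₂ (proj₂ x-conic) }
    where
    0·x≡0 : ∀ v → (λ _ → 0ℚ) · v ≡ 0ℚ
    0·x≡0 v = trans (∑-cong (λ k → *-zeroˡ (v k))) (∑-zero m)

  ½ : ℚ
  ½ = ℤ.+ 1 / 2

  0<½ : 0ℚ < ½
  0<½ = positive⁻¹ ½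

  merge : Certificate → Certificate → Certificate
  merge c c′ = record
    { normal = λ k → normal c k + normal c′ k
    ; normal-valid = λ i → subst (0ℚ ≤_) (sym (+-· (normal c) (normal c′) (g i))) (+-mono-≤ (normal-valid c i) (normal-valid c′ i))
    ; normal-tight = trans (+-· (normal c) (normal c′) x) (trans (cong₂ _+_ (normal-tight c) (normal-tight c′)) (+-identityʳ 0ℚ))
    ; coeffs = λ i → ½ * coeffs c i + (1ℚ - ½) * coeffs c′ i
    ; coeffs-nonNeg = λ i → +-mono-≤ (*-nonNeg (<⇒≤ 0<½) (coeffs-nonNeg c i)) (*-nonNeg (<⇒≤ 0<½) (coeffs-nonNeg c′ i))
    ; coeffs-rep = lin-affine g ½ (coeffs c) (coeffs c′) (coeffs-rep c) (coeffs-rep c′) }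

  merge-coversˡ : ∀ c c′ {i} → Covers c i → Covers (merge c c′) i
  merge-coversˡ c c′ {i} (inj₁ 0<ρ) =
    inj₁ (+-mono-<-≤ (*-pos 0<½ 0<ρ) (*-nonNeg (<⇒≤ 0<½) (coeffs-nonNeg c′ i)))
  merge-coversˡ c c′ {i} (inj₂ 0<wg) =
    inj₂ (subst (0ℚ <_) (sym (+-· (normal c) (normal c′) (g i))) (+-mono-<-≤ 0<wg (normal-valid c′ i)))

  merge-coversʳ : ∀ c c′ {i} → Covers c′ i → Covers (merge c c′) i
  merge-coversʳ c c′ {i} (inj₁ 0<ρ) =
    inj₁ (+-mono-≤-< (*-nonNeg (<⇒≤ 0<½) (coeffs-nonNeg c i)) (*-pos 0<½ 0<ρ))
  merge-coversʳ c c′ {i} (inj₂ 0<wg) =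
    inj₂ (subst (0ℚ <_) (sym (+-· (normal c) (normal c′) (g i))) (+-mono-≤-< (normal-valid c i) 0<wg))

  -x∷g : Fin (ℕ.suc n) → Vecℚ m
  -x∷g zero k  = - x k
  -x∷g (suc i) = g i

  certificate-using : ∀ j → Conic -x∷g (λ k → - g j k) → Σ Certificate (λ c → 0ℚ < coeffs c j)
  certificate-using j (μ , 0≤μ , μ-rep) = c , *-pos 0<1/s (+-mono-<-≤ (+-mono-≤-< (ν₀-nonNeg j) 0<δjj) (0≤μ (suc j)))
    where
    ν₀-nonNeg = coeffs-nonNeg trivial
    0<δjj = <-respʳ-≡ (sym (δ-diag j)) 0<1
    s = 1ℚ + μ zero
    instance
      s-positive : ℚ.Positive s
      s-positive = positive (+-mono-<-≤ 0<1 (0≤μ zero))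
      s-nonZero : ℚ.NonZero s
      s-nonZero = pos⇒nonZero s
    0<1/s : 0ℚ < 1/ s
    0<1/s = positive⁻¹ (1/ s) {{1/pos⇒pos s}}
    T : Fin n → ℚ
    T i = ν₀ i + δ j i + μ (suc i)
    L = lin g (μ ∘ suc)
    T-rep : ∀ k → lin g T k ≡ s * x k
    T-rep k = begin
      lin g T k                                  ≡⟨ lin-+ g (λ i → ν₀ i + δ j i) (μ ∘ suc) k ⟩
      lin g (λ i → ν₀ i + δ j i) k + L k         ≡⟨ cong (_+ L k) (trans (lin-+ g ν₀ (δ j) k) (cong₂ _+_ (coeffs-rep trivial k) (∑-δ j (λ i → g i k)))) ⟩
      x k + g j k + L k                          ≡⟨ solve 4 (λ x a l u → x :+ a :+ l := (con 1ℚ :+ u) :* x :+ ((u :* (:- x) :+ l) :+ a)) refl (x k) (g j k) (L k) (μ zero) ⟩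
      s * x k + ((μ zero * - x k + L k) + g j k) ≡⟨ cong (λ z → s * x k + (z + g j k)) (μ-rep k) ⟩
      s * x k + (- g j k + g j k)                ≡⟨ solve 2 (λ y a → y :+ (:- a :+ a) := y) refl (s * x k) (g j k) ⟩
      s * x k                                    ∎
      where open ≡-Reasoning
    c : Certificate
    c = record
      { normal = normal trivial ; normal-valid = normal-valid trivial ; normal-tight = normal-tight trivial
      ; coeffs = λ i → 1/ s * T i
      ; coeffs-nonNeg = λ i → *-nonNeg (<⇒≤ 0<1/s) (+-mono-≤ (+-mono-≤ (ν₀-nonNeg i) (0≤δ j i)) (0≤μ (suc i)))
      ; coeffs-rep = λ k → trans (lin-* g (1/ s) T k) (trans (cong (1/ s *_) (T-rep k))
          (trans (sym (*-assoc (1/ s) s (x k))) (trans (cong (_* x k) (*-inverseˡ s)) (*-identityˡ (x k))))) }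

  certificate-separating : ∀ j → Separable -x∷g (λ k → - g j k) → Σ Certificate (λ c → 0ℚ < normal c · g j)
  certificate-separating j (w , w-valid , w·-gj<0) = c , 0<w·gj
    where
    0<w·gj : 0ℚ < w · g j
    0<w·gj = <-respʳ-≡ (-‿involutive (w · g j)) (neg-antimono-< (<-respˡ-≡ (·-neg w (g j)) w·-gj<0))
    w·x≤0 : w · x ≤ 0ℚ
    w·x≤0 = ≤-trans (≤-reflexive (sym (-‿involutive (w · x)))) (neg-antimono-≤ (≤-trans (w-valid zero) (≤-reflexive (·-neg w x))))
    c : Certificate
    c = record
      { normal = w ; normal-valid = w-valid ∘ suc
      ; normal-tight = ≤-antisym w·x≤0 (valid-conic-nonNeg g w (w-valid ∘ suc) x-conic)
      ; coeffs = ν₀ ; coeffs-nonNeg = coeffs-nonNeg trivial ; coeffs-rep = coeffs-rep trivial }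

  -- Farkas' lemma for -x, g₁, …, gₙ and -gⱼ: either μ₀ x - gⱼ is conic for some μ₀ ≥ 0, and then x has
  -- a conic representation using gⱼ, or some valid normal vanishes on x but not on gⱼ.
  covering-certificate : ∀ j → Σ Certificate (λ c → Covers c j)
  covering-certificate j with farkas (ℕ.suc n) -x∷g (λ k → - g j k)
  ... | inj₁ conic     = map₂ inj₁ (certificate-using j conic)
  ... | inj₂ separable = map₂ inj₂ (certificate-separating j separable)

  covering-all : ∀ {l} (js : Fin l → Fin n) → Σ Certificate (λ c → ∀ t → Covers c (js t))
  covering-all {ℕ.zero}  js = trivial , λ ()
  covering-all {ℕ.suc l} js with covering-certificate (js zero) | covering-all (js ∘ suc)
  ... | c , c-covers | c′ , c′-covers = merge c c′ , λ
    { zero    → merge-coversˡ c c′ c-covers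
    ; (suc t) → merge-coversʳ c c′ (c′-covers t) }

  -- x lies in the relative interior of the face cut out by the normal.
  interior-certificate : Σ Certificate (λ c → ∀ i → normal c · g i ≡ 0ℚ → 0ℚ < coeffs c i)
  interior-certificate with covering-all (λ i → i)
  ... | c , covers = c , interior
    where
    interior : ∀ i → normal c · g i ≡ 0ℚ → 0ℚ < coeffs c i
    interior i wg≡0 with covers i
    ... | inj₁ 0<ρ  = 0<ρ
    ... | inj₂ 0<wg = ⊥-elim (<-irrefl (sym wg≡0) 0<wg)

ι : ℤ → ℚ
ι z = z / 1

/-≡ : ∀ z z′ d d′ .{{_ : NonZero d}} .{{_ : NonZero d′}} → z ℤ.* ℤ.+ d′ ≡ z′ ℤ.* ℤ.+ d → z / d ≡ z′ / d′
/-≡ z z′ (ℕ.suc d) (ℕ.suc d′) eq = fromℚᵘ-cong {ℚᵘ.mkℚᵘ z d} {ℚᵘ.mkℚᵘ z′ d′} (ℚᵘ.*≡* eq)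

/-≤ : ∀ z z′ d d′ .{{_ : NonZero d}} .{{_ : NonZero d′}} → z ℤ.* ℤ.+ d′ ℤ.≤ z′ ℤ.* ℤ.+ d → z / d ≤ z′ / d′
/-≤ z z′ (ℕ.suc d) (ℕ.suc d′) le = toℚᵘ-cancel-≤
  (ℚᵘ.≤-respˡ-≃ (ℚᵘ.≃-sym (toℚᵘ-fromℚᵘ (ℚᵘ.mkℚᵘ z d)))
  (ℚᵘ.≤-respʳ-≃ (ℚᵘ.≃-sym (toℚᵘ-fromℚᵘ (ℚᵘ.mkℚᵘ z′ d′))) (ℚᵘ.*≤* le)))

/-+ : ∀ z z′ d d′ .{{_ : NonZero d}} .{{_ : NonZero d′}} →
  z / d + z′ / d′ ≡ _/_ (z ℤ.* ℤ.+ d′ ℤ.+ z′ ℤ.* ℤ.+ d) (d ℕ.* d′) {{ℕ.m*n≢0 d d′}}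
/-+ z z′ (ℕ.suc d) (ℕ.suc d′) = toℚᵘ-injective
  (ℚᵘ.≃-trans (toℚᵘ-homo-+ (z / ℕ.suc d) (z′ / ℕ.suc d′))
  (ℚᵘ.≃-trans (ℚᵘ.+-cong (toℚᵘ-fromℚᵘ (ℚᵘ.mkℚᵘ z d)) (toℚᵘ-fromℚᵘ (ℚᵘ.mkℚᵘ z′ d′)))
  (ℚᵘ.≃-sym (toℚᵘ-fromℚᵘ (ℚᵘ.mkℚᵘ z d ℚᵘ.+ ℚᵘ.mkℚᵘ z′ d′)))))

/-* : ∀ z z′ d d′ .{{_ : NonZero d}} .{{_ : NonZero d′}} →
  (z / d) * (z′ / d′) ≡ _/_ (z ℤ.* z′) (d ℕ.* d′) {{ℕ.m*n≢0 d d′}}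
/-* z z′ (ℕ.suc d) (ℕ.suc d′) = toℚᵘ-injective
  (ℚᵘ.≃-trans (toℚᵘ-homo-* (z / ℕ.suc d) (z′ / ℕ.suc d′))
  (ℚᵘ.≃-trans (ℚᵘ.*-cong (toℚᵘ-fromℚᵘ (ℚᵘ.mkℚᵘ z d)) (toℚᵘ-fromℚᵘ (ℚᵘ.mkℚᵘ z′ d′)))
  (ℚᵘ.≃-sym (toℚᵘ-fromℚᵘ (ℚᵘ.mkℚᵘ z d ℚᵘ.* ℚᵘ.mkℚᵘ z′ d′)))))

-‿/ : ∀ z d .{{_ : NonZero d}} → - (z / d) ≡ (ℤ.- z) / d
-‿/ z (ℕ.suc d) = toℚᵘ-injective
  (ℚᵘ.≃-trans (toℚᵘ-homo‿- (z / ℕ.suc d))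
  (ℚᵘ.≃-trans (ℚᵘ.-‿cong (toℚᵘ-fromℚᵘ (ℚᵘ.mkℚᵘ z d)))
  (ℚᵘ.≃-sym (toℚᵘ-fromℚᵘ (ℚᵘ.- ℚᵘ.mkℚᵘ z d)))))

ι-+ : ∀ a b → ι (a ℤ.+ b) ≡ ι a + ι b
ι-+ a b = sym (trans (/-+ a b 1 1) (/-≡ (a ℤ.* ℤ.+ 1 ℤ.+ b ℤ.* ℤ.+ 1) (a ℤ.+ b) 1 1 (cong (ℤ._* ℤ.+ 1) (cong₂ ℤ._+_ (ℤ.*-identityʳ a) (ℤ.*-identityʳ b)))))

ι-* : ∀ a b → ι (a ℤ.* b) ≡ ι a * ι b
ι-* a b = sym (/-* a b 1 1)

ι-neg : ∀ a → ι (ℤ.- a) ≡ - ι a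
ι-neg a = sym (-‿/ a 1)

ι-≤ : ∀ {a b} → a ℤ.≤ b → ι a ≤ ι b
ι-≤ {a} {b} a≤b = /-≤ a b 1 1 (subst₂ ℤ._≤_ (sym (ℤ.*-identityʳ a)) (sym (ℤ.*-identityʳ b)) a≤b)

ι-sum : ∀ {n} (f : Fin n → ℤ) → ι (ℤSum.sum f) ≡ ∑ (ι ∘ f)
ι-sum {ℕ.zero}  f = refl
ι-sum {ℕ.suc n} f = trans (ι-+ (f zero) (ℤSum.sum (f ∘ suc))) (cong (ι (f zero) +_) (ι-sum (f ∘ suc)))

ι-ℕ-mono : ∀ {k l} → k ℕ.≤ l → ι (ℤ.+ k) ≤ ι (ℤ.+ l)
ι-ℕ-mono k≤l = ι-≤ (ℤ.+≤+ k≤l)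

*-↧≡↥ : ∀ q → q * ι (ℤ.+ ↧ₙ q) ≡ ι (↥ q)
*-↧≡↥ q = begin
  q * ι (ℤ.+ ↧ₙ q)                              ≡⟨ cong (_* ι (ℤ.+ ↧ₙ q)) (sym (↥p/↧p≡p q)) ⟩
  (↥ q / ↧ₙ q) * ι (ℤ.+ ↧ₙ q)                   ≡⟨ /-* (↥ q) (ℤ.+ ↧ₙ q) (↧ₙ q) 1 ⟩
  _/_ (↥ q ℤ.* ℤ.+ ↧ₙ q) (↧ₙ q ℕ.* 1) {{ℕ.m*n≢0 (↧ₙ q) 1}} ≡⟨ /-≡ (↥ q ℤ.* ℤ.+ ↧ₙ q) (↥ q) (↧ₙ q ℕ.* 1) 1 {{ℕ.m*n≢0 (↧ₙ q) 1}} cross ⟩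
  ι (↥ q)                                       ∎
  where
  open ≡-Reasoning
  cross : ↥ q ℤ.* ℤ.+ ↧ₙ q ℤ.* ℤ.+ 1 ≡ ↥ q ℤ.* ℤ.+ (↧ₙ q ℕ.* 1)
  cross = trans (ℤ.*-identityʳ _) (cong (λ d → ↥ q ℤ.* ℤ.+ d) (sym (ℕ.*-identityʳ (↧ₙ q))))

ι-ℕ-+ : ∀ a b → ι (ℤ.+ (a ℕ.+ b)) ≡ ι (ℤ.+ a) + ι (ℤ.+ b)
ι-ℕ-+ a b = trans (cong ι (ℤ.pos-+ a b)) (ι-+ (ℤ.+ a) (ℤ.+ b))

ι-ℕ-* : ∀ a b → ι (ℤ.+ (a ℕ.* b)) ≡ ι (ℤ.+ a) * ι (ℤ.+ b)
ι-ℕ-* a b = trans (cong ι (ℤ.pos-* a b)) (ι-* (ℤ.+ a) (ℤ.+ b))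

archimedean : ∀ q → ∃ λ K → q ≤ ι (ℤ.+ K)
archimedean q@(mkℚ z d _) = ℤ.∣ z ∣ , ≤-trans (≤-reflexive (sym (↥p/↧p≡p q)))
  (/-≤ z (ℤ.+ ℤ.∣ z ∣) (ℕ.suc d) 1 (subst₂ ℤ._≤_ (sym (ℤ.*-identityʳ z)) (ℤ.pos-* ℤ.∣ z ∣ (ℕ.suc d)) (z≤∣z∣*d z)))
  where
  z≤∣z∣*d : ∀ z → z ℤ.≤ ℤ.+ (ℤ.∣ z ∣ ℕ.* ℕ.suc d)
  z≤∣z∣*d (ℤ.+ n)    = ℤ.+≤+ (ℕ.m≤m*n n (ℕ.suc d))
  z≤∣z∣*d ℤ.-[1+ n ] = ℤ.-≤+

archimedean-multiple : ∀ l ν → ∃ λ K → 0ℚ < ν → l ≤ ι (ℤ.+ K) * ν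
archimedean-multiple l ν with 0ℚ <? ν
... | no 0≮ν = 0 , λ 0<ν → ⊥-elim (0≮ν 0<ν)
... | yes 0<ν = K , λ _ → begin
    l                  ≡⟨ sym (*-identityʳ l) ⟩
    l * 1ℚ             ≡⟨ cong (l *_) (sym (*-inverseˡ ν)) ⟩
    l * (1/ ν * ν)     ≡⟨ sym (*-assoc l (1/ ν) ν) ⟩
    l * 1/ ν * ν       ≤⟨ *-monoʳ-≤-nonNeg ν (proj₂ (archimedean (l * 1/ ν))) ⟩
    ι (ℤ.+ K) * ν      ∎
  where
  open ≤-Reasoning
  instance
    ν-nonNeg : ℚ.NonNegative ν
    ν-nonNeg = nonNegative (<⇒≤ 0<ν)
    ν-nonZero : ℚ.NonZero ν
    ν-nonZero = pos⇒nonZero ν {{positive 0<ν}}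
  K = proj₁ (archimedean (l * 1/ ν))

uniform-bound : ∀ {n} (P : Fin n → ℕ → Set) → (∀ i {k l} → k ℕ.≤ l → P i k → P i l) →
  (∀ i → ∃ (P i)) → ∃ λ K → ∀ i → P i K
uniform-bound {ℕ.zero}  P mono bound = 0 , λ ()
uniform-bound {ℕ.suc n} P mono bound with uniform-bound (P ∘ suc) (mono ∘ suc) (bound ∘ suc)
... | K , PK = K₀ ℕ.+ K , λ
  { zero    → mono zero (ℕ.m≤m+n K₀ K) (proj₂ (bound zero))
  ; (suc i) → mono (suc i) (ℕ.m≤n+m K K₀) (PK i) }
  where K₀ = proj₁ (bound zero)

common-denominator : ∀ {n} (q : Fin n → ℚ) → ∃ λ D → NonZero D × (∀ i → ∃ λ z → q i * ι (ℤ.+ D) ≡ ι z)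
common-denominator {ℕ.zero}  q = 1 , _ , λ ()
common-denominator {ℕ.suc n} q with common-denominator (q ∘ suc)
... | D , D≢0 , Dq = d₀ ℕ.* D , ℕ.m*n≢0 d₀ D {{_}} {{D≢0}} , clears
  where
  d₀ = ↧ₙ q zero
  clears : ∀ i → ∃ λ z → q i * ι (ℤ.+ (d₀ ℕ.* D)) ≡ ι z
  clears zero = ↥ q zero ℤ.* ℤ.+ D , (begin
    q zero * ι (ℤ.+ (d₀ ℕ.* D))          ≡⟨ cong (q zero *_) (ι-ℕ-* d₀ D) ⟩
    q zero * (ι (ℤ.+ d₀) * ι (ℤ.+ D))    ≡⟨ sym (*-assoc (q zero) _ _) ⟩
    q zero * ι (ℤ.+ d₀) * ι (ℤ.+ D)      ≡⟨ cong (_* ι (ℤ.+ D)) (*-↧≡↥ (q zero)) ⟩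
    ι (↥ q zero) * ι (ℤ.+ D)             ≡⟨ sym (ι-* (↥ q zero) (ℤ.+ D)) ⟩
    ι (↥ q zero ℤ.* ℤ.+ D)               ∎)
    where open ≡-Reasoning
  clears (suc i) = proj₁ (Dq i) ℤ.* ℤ.+ d₀ , (begin
    q (suc i) * ι (ℤ.+ (d₀ ℕ.* D))       ≡⟨ cong (q (suc i) *_) (trans (ι-ℕ-* d₀ D) (*-comm (ι (ℤ.+ d₀)) _)) ⟩
    q (suc i) * (ι (ℤ.+ D) * ι (ℤ.+ d₀)) ≡⟨ sym (*-assoc (q (suc i)) _ _) ⟩
    q (suc i) * ι (ℤ.+ D) * ι (ℤ.+ d₀)   ≡⟨ cong (_* ι (ℤ.+ d₀)) (proj₂ (Dq i)) ⟩
    ι (proj₁ (Dq i)) * ι (ℤ.+ d₀)        ≡⟨ sym (ι-* (proj₁ (Dq i)) (ℤ.+ d₀)) ⟩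
    ι (proj₁ (Dq i) ℤ.* ℤ.+ d₀)          ∎)
    where open ≡-Reasoning

n≤p^n : ∀ p → 1 ℕ.< p → ∀ n → n ℕ.≤ p ℕ.^ n
n≤p^n p 1<p ℕ.zero    = ℕ.z≤n
n≤p^n p 1<p (ℕ.suc n) = begin
  ℕ.suc n                    ≤⟨ ℕ.+-mono-≤ (ℕ.m^n>0 p n) (n≤p^n p 1<p n) ⟩
  p ℕ.^ n ℕ.+ p ℕ.^ n        ≡⟨ cong (p ℕ.^ n ℕ.+_) (sym (ℕ.+-identityʳ (p ℕ.^ n))) ⟩
  2 ℕ.* p ℕ.^ n              ≤⟨ ℕ.*-monoˡ-≤ (p ℕ.^ n) 1<p ⟩
  p ℕ.^ ℕ.suc n              ∎
  where
  open ℕ.≤-Reasoning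
  instance
    p≢0 : NonZero p
    p≢0 = ℕ.>-nonZero (ℕ.<-trans ℕ.z<s 1<p)

-- p-adic convex combinations

mix-nonNeg : ∀ {γ κ l ν} → 0ℚ ≤ γ → 0ℚ ≤ ν → γ * (κ + 1ℚ) ≤ 1ℚ → - l ≤ κ * ν → 0ℚ ≤ γ * l + (1ℚ - γ) * ν
mix-nonNeg {γ} {κ} {l} {ν} 0≤γ 0≤ν γ[κ+1]≤1 -l≤κν = begin
  0ℚ                                  ≤⟨ *-nonNeg 0≤1-γ[κ+1] 0≤ν ⟩
  (1ℚ - γ * (κ + 1ℚ)) * ν             ≡⟨ solve 3 (λ γ κ ν → (con 1ℚ :+ :- (γ :* (κ :+ con 1ℚ))) :* ν := γ :* (:- (κ :* ν)) :+ (con 1ℚ :+ :- γ) :* ν) refl γ κ ν ⟩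
  γ * - (κ * ν) + (1ℚ - γ) * ν        ≤⟨ +-monoˡ-≤ ((1ℚ - γ) * ν) (*-monoˡ-≤-nonNeg γ {{nonNegative 0≤γ}} -κν≤l) ⟩
  γ * l + (1ℚ - γ) * ν                ∎
  where
  open ≤-Reasoning
  0≤1-γ[κ+1] : 0ℚ ≤ 1ℚ - γ * (κ + 1ℚ)
  0≤1-γ[κ+1] = ≤-trans (≤-reflexive (sym (+-inverseʳ (γ * (κ + 1ℚ))))) (+-monoˡ-≤ (- (γ * (κ + 1ℚ))) γ[κ+1]≤1)
  -κν≤l : - (κ * ν) ≤ l
  -κν≤l = ≤-trans (neg-antimono-≤ -l≤κν) (≤-reflexive (-‿involutive l))

module PAdic (p : ℕ) (1<p : 1 ℕ.< p) where

  instance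
    p≢0 : NonZero p
    p≢0 = ℕ.>-nonZero (ℕ.<-trans ℕ.z<s 1<p)

  padic-ι : ∀ z → IsPAdic p (ι z)
  padic-ι z = 0 , z , ℕ.m^n≢0 p 0 , refl

  padic-+ : ∀ {q q′} → IsPAdic p q → IsPAdic p q′ → IsPAdic p (q + q′)
  padic-+ (k , a , nz , refl) (k′ , a′ , nz′ , refl) = k ℕ.+ k′ , N , ℕ.m^n≢0 p (k ℕ.+ k′) ,
    trans (/-+ a a′ (p ℕ.^ k) (p ℕ.^ k′) {{nz}} {{nz′}})
          (/-cong {N} {{ℕ.m*n≢0 _ _ {{nz}} {{nz′}}}} {{ℕ.m^n≢0 p (k ℕ.+ k′)}} refl (sym (ℕ.^-distribˡ-+-* p k k′)))
    where N = a ℤ.* ℤ.+ (p ℕ.^ k′) ℤ.+ a′ ℤ.* ℤ.+ (p ℕ.^ k)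

  padic-* : ∀ {q q′} → IsPAdic p q → IsPAdic p q′ → IsPAdic p (q * q′)
  padic-* (k , a , nz , refl) (k′ , a′ , nz′ , refl) = k ℕ.+ k′ , a ℤ.* a′ , ℕ.m^n≢0 p (k ℕ.+ k′) ,
    trans (/-* a a′ (p ℕ.^ k) (p ℕ.^ k′) {{nz}} {{nz′}})
          (/-cong {a ℤ.* a′} {{ℕ.m*n≢0 _ _ {{nz}} {{nz′}}}} {{ℕ.m^n≢0 p (k ℕ.+ k′)}} refl (sym (ℕ.^-distribˡ-+-* p k k′)))

  record SplitOfOne (D K : ℕ) : Set where
    field
      γ         : ℚ
      u         : ℚ
      γ-padic   : IsPAdic p γ
      u-padic   : IsPAdic p u
      γ-nonNeg  : 0ℚ ≤ γ
      γ-small   : γ * (ι (ℤ.+ K) + 1ℚ) ≤ 1ℚ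
      split     : γ + u * ι (ℤ.+ D) ≡ 1ℚ

  -- Writing p^J = r + u D with r < D and J = D (K + 1), take γ = r / p^J.
  split-of-one : ∀ D .{{_ : NonZero D}} K → SplitOfOne D K
  split-of-one D K = record
    { γ = γ ; u = u′ ; γ-padic = J , ℤ.+ r , P≢0 , refl ; u-padic = J , ℤ.+ u , P≢0 , refl
    ; γ-nonNeg = 0≤γ ; γ-small = γ-small ; split = γ+u′D≡1 }
    where
    J = D ℕ.* (K ℕ.+ 1)
    P = p ℕ.^ J
    instance
      P≢0 : NonZero P
      P≢0 = ℕ.m^n≢0 p J
    r = P ℕ.% D
    u = P ℕ./ D
    γ = ℤ.+ r / P
    u′ = ℤ.+ u / P
    ε = ℤ.+ 1 / P

    /P≡*ε : ∀ z → z / P ≡ ι z * ε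
    /P≡*ε z = sym (trans (/-* z (ℤ.+ 1) 1 P) (/-≡ (z ℤ.* ℤ.+ 1) z (1 ℕ.* P) P {{ℕ.m*n≢0 1 P}} cross))
      where
      cross : z ℤ.* ℤ.+ 1 ℤ.* ℤ.+ P ≡ z ℤ.* ℤ.+ (1 ℕ.* P)
      cross = trans (cong (ℤ._* ℤ.+ P) (ℤ.*-identityʳ z)) (cong (λ d → z ℤ.* ℤ.+ d) (sym (ℕ.*-identityˡ P)))

    ιP*ε≡1 : ι (ℤ.+ P) * ε ≡ 1ℚ
    ιP*ε≡1 = trans (sym (/P≡*ε (ℤ.+ P))) (/-≡ (ℤ.+ P) (ℤ.+ 1) P 1 (trans (ℤ.*-identityʳ (ℤ.+ P)) (sym (ℤ.*-identityˡ (ℤ.+ P)))))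

    0≤ε : 0ℚ ≤ ε
    0≤ε = nonNegative⁻¹ ε {{normalize-nonNeg 1 P}}

    0≤γ : 0ℚ ≤ γ
    0≤γ = nonNegative⁻¹ γ {{normalize-nonNeg r P}}

    γ+u′D≡1 : γ + u′ * ι (ℤ.+ D) ≡ 1ℚ
    γ+u′D≡1 = begin
      γ + u′ * ι (ℤ.+ D)                          ≡⟨ cong₂ (λ s t → s + t * ι (ℤ.+ D)) (/P≡*ε (ℤ.+ r)) (/P≡*ε (ℤ.+ u)) ⟩
      ι (ℤ.+ r) * ε + ι (ℤ.+ u) * ε * ι (ℤ.+ D)   ≡⟨ solve 4 (λ r e u d → r :* e :+ u :* e :* d := (r :+ u :* d) :* e) refl (ι (ℤ.+ r)) ε (ι (ℤ.+ u)) (ι (ℤ.+ D)) ⟩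
      (ι (ℤ.+ r) + ι (ℤ.+ u) * ι (ℤ.+ D)) * ε     ≡⟨ cong (_* ε) (sym (trans (ι-ℕ-+ r (u ℕ.* D)) (cong (ι (ℤ.+ r) +_) (ι-ℕ-* u D)))) ⟩
      ι (ℤ.+ (r ℕ.+ u ℕ.* D)) * ε                 ≡⟨ cong (λ n → ι (ℤ.+ n) * ε) (sym (ℕ.m≡m%n+[m/n]*n P D)) ⟩
      ι (ℤ.+ P) * ε                               ≡⟨ ιP*ε≡1 ⟩
      1ℚ                                          ∎
      where open ≡-Reasoning

    r[K+1]≤P : r ℕ.* (K ℕ.+ 1) ℕ.≤ P
    r[K+1]≤P = ℕ.≤-trans (ℕ.*-monoˡ-≤ (K ℕ.+ 1) (ℕ.<⇒≤ (ℕ.m%n<n P D))) (n≤p^n p 1<p J)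

    γ-small : γ * (ι (ℤ.+ K) + 1ℚ) ≤ 1ℚ
    γ-small = begin
      γ * (ι (ℤ.+ K) + 1ℚ)                ≡⟨ cong₂ _*_ (/P≡*ε (ℤ.+ r)) (sym (ι-ℕ-+ K 1)) ⟩
      ι (ℤ.+ r) * ε * ι (ℤ.+ (K ℕ.+ 1))   ≡⟨ solve 3 (λ r e k → r :* e :* k := r :* k :* e) refl (ι (ℤ.+ r)) ε (ι (ℤ.+ (K ℕ.+ 1))) ⟩
      ι (ℤ.+ r) * ι (ℤ.+ (K ℕ.+ 1)) * ε   ≡⟨ cong (_* ε) (sym (ι-ℕ-* r (K ℕ.+ 1))) ⟩
      ι (ℤ.+ (r ℕ.* (K ℕ.+ 1))) * ε       ≤⟨ *-monoʳ-≤-nonNeg ε {{nonNegative 0≤ε}} (ι-ℕ-mono r[K+1]≤P) ⟩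
      ι (ℤ.+ P) * ε                       ≡⟨ ιP*ε≡1 ⟩
      1ℚ                                  ∎
      where open ≤-Reasoning

  padic-mix : ∀ {n} (ν λ₀ : Fin n → ℚ) → (∀ i → 0ℚ ≤ ν i) → (∀ i → IsPAdic p (λ₀ i)) →
    (∀ i → 0ℚ < ν i ⊎ λ₀ i ≡ 0ℚ) →
    ∃ λ γ → ∀ i → 0ℚ ≤ γ * λ₀ i + (1ℚ - γ) * ν i × IsPAdic p (γ * λ₀ i + (1ℚ - γ) * ν i)
  padic-mix ν λ₀ 0≤ν λ₀-padic ν>0⊎λ₀≡0
    with common-denominator ν | uniform-bound (λ i K → 0ℚ < ν i → - λ₀ i ≤ ι (ℤ.+ K) * ν i) mono
                                  (λ i → archimedean-multiple (- λ₀ i) (ν i))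
    where
    mono : ∀ i {k l} → k ℕ.≤ l → (0ℚ < ν i → - λ₀ i ≤ ι (ℤ.+ k) * ν i) → 0ℚ < ν i → - λ₀ i ≤ ι (ℤ.+ l) * ν i
    mono i k≤l bound 0<ν = ≤-trans (bound 0<ν) (*-monoʳ-≤-nonNeg (ν i) {{nonNegative (0≤ν i)}} (ι-ℕ-mono k≤l))
  ... | D , D≢0 , Dν | K , bound =
    γ , λ i → mix-nonNeg {κ = ι (ℤ.+ K)} γ-nonNeg (0≤ν i) γ-small (-λ₀≤Kν i) , padic-+ (padic-* γ-padic (λ₀-padic i)) (complement-padic i)
    where
    open SplitOfOne (split-of-one D {{D≢0}} K)

    -λ₀≤Kν : ∀ i → - λ₀ i ≤ ι (ℤ.+ K) * ν i
    -λ₀≤Kν i with ν>0⊎λ₀≡0 i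
    ... | inj₁ 0<ν = bound i 0<ν
    ... | inj₂ λ₀≡0 = subst (λ l → - l ≤ ι (ℤ.+ K) * ν i) (sym λ₀≡0) (*-nonNeg (ι-ℕ-mono {l = K} ℕ.z≤n) (0≤ν i))

    complement-padic : ∀ i → IsPAdic p ((1ℚ - γ) * ν i)
    complement-padic i = subst (IsPAdic p) (sym (begin
      (1ℚ - γ) * ν i              ≡⟨ cong (λ s → (s - γ) * ν i) (sym split) ⟩
      (γ + u * ι (ℤ.+ D) - γ) * ν i ≡⟨ solve 4 (λ g u d v → (g :+ u :* d :+ :- g) :* v := u :* (v :* d)) refl γ u (ι (ℤ.+ D)) (ν i) ⟩
      u * (ν i * ι (ℤ.+ D))       ≡⟨ cong (u *_) (proj₂ (Dν i)) ⟩
      u * ι (proj₁ (Dν i))        ∎)) (padic-* u-padic (padic-ι (proj₁ (Dν i))))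
      where open ≡-Reasoning

-- Faces of cone {a¹, …, aⁿ}

comb-ℤ : ∀ {n m} (a : Fin n → Vecℤ m) (t : Fin n → ℤ) → ∀ k → comb a (ι ∘ t) k ≡ ι (ℤSum.sum (λ i → t i ℤ.* a i k))
comb-ℤ a t k = trans (∑-cong (λ i → sym (ι-* (t i) (a i k)))) (sym (ι-sum (λ i → t i ℤ.* a i k)))

module Faces (p : ℕ) (1<p : 1 ℕ.< p) {n m : ℕ} (a : Fin n → Vecℤ m) where
  open PAdic p 1<p

  A : Fin n → Vecℚ m
  A i = embed (a i)

  Face : Vecℚ m → Fin n → Set
  Face w i = InFace a w (A i)

  A∈cone : ∀ i → InCone a (A i)
  A∈cone i = δ i , 0≤δ i , λ k → ∑-δ i (λ j → A j k)

  ¬Face⇒≢0 : ∀ w i → ¬ Face w i → w · A i ≢ 0ℚ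
  ¬Face⇒≢0 w i ¬face w·Ai≡0 = ¬face (A∈cone i , w·Ai≡0)

  valid⇒ : ∀ w → ValidIneq a w → ∀ i → 0ℚ ≤ w · A i
  valid⇒ w w-valid i = w-valid (A i) (A∈cone i)

  ⇒valid : ∀ w → (∀ i → 0ℚ ≤ w · A i) → ValidIneq a w
  ⇒valid w w-valid x x∈cone = valid-conic-nonNeg A w w-valid x∈cone

  span-face-tight : ∀ w {κ : Fin n → ℚ} {y : Vecℚ m} →
    (∀ i → ¬ Face w i → κ i ≡ 0ℚ) → (∀ k → comb a κ k ≡ y k) → w · y ≡ 0ℚ
  span-face-tight w {κ} {y} κ-supp κ-rep = begin
    w · y                        ≡⟨ ·-cong w (λ k → sym (κ-rep k)) ⟩
    w · comb a κ                 ≡⟨ ·-lin w A κ ⟩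
    ∑ (λ i → κ i * (w · A i))    ≡⟨ ∑-cong term≡0 ⟩
    ∑ {n} (λ _ → 0ℚ)             ≡⟨ ∑-zero n ⟩
    0ℚ                           ∎
    where
    open ≡-Reasoning
    term≡0 : ∀ i → κ i * (w · A i) ≡ 0ℚ
    term≡0 i with w · A i ≟ 0ℚ
    ... | yes on = trans (cong (κ i *_) on) (*-zeroʳ (κ i))
    ... | no off = trans (cong (_* (w · A i)) (κ-supp i (λ face → off (proj₂ face)))) (*-zeroˡ (w · A i))

  shift : Vecℤ m → (Fin n → ℤ) → Vecℤ m
  shift x t k = x k ℤ.+ ℤSum.sum (λ i → t i ℤ.* a i k)

  comb-shift : ∀ x t (κ : Fin n → ℚ) → (∀ k → comb a κ k ≡ embed x k) →
    ∀ k → comb a (λ i → κ i + ι (t i)) k ≡ embed (shift x t) k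
  comb-shift x t κ κ-rep k = begin
    comb a (λ i → κ i + ι (t i)) k    ≡⟨ lin-+ A κ (ι ∘ t) k ⟩
    comb a κ k + comb a (ι ∘ t) k     ≡⟨ cong₂ _+_ (κ-rep k) (comb-ℤ a t k) ⟩
    ι (x k) + ι s                     ≡⟨ sym (ι-+ (x k) s) ⟩
    embed (shift x t) k               ∎
    where
    open ≡-Reasoning
    s = ℤSum.sum (λ i → t i ℤ.* a i k)

  comb-unshift : ∀ x t (μ : Fin n → ℚ) → (∀ k → comb a μ k ≡ embed (shift x t) k) →
    ∀ k → comb a (λ i → μ i - ι (t i)) k ≡ embed x k
  comb-unshift x t μ μ-rep k = begin
    comb a (λ i → μ i - ι (t i)) k                ≡⟨ lin-+ A μ (λ i → - ι (t i)) k ⟩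
    comb a μ k + comb a (λ i → - ι (t i)) k       ≡⟨ cong₂ _+_ (μ-rep k) (trans (lin-neg A (ι ∘ t) k) (cong -_ (comb-ℤ a t k))) ⟩
    ι (x k ℤ.+ s) - ι s                           ≡⟨ cong (_- ι s) (ι-+ (x k) s) ⟩
    ι (x k) + ι s - ι s                           ≡⟨ solve 2 (λ x s → x :+ s :+ :- s := x) refl (ι (x k)) (ι s) ⟩
    embed x k                                     ∎
    where
    open ≡-Reasoning
    s = ℤSum.sum (λ i → t i ℤ.* a i k)

  onFace : Vecℚ m → ℕ → Fin n → ℤ
  onFace w N i = if does (w · A i ≟ 0ℚ) then ℤ.+ N else ℤ.+ 0

  onFace-on : ∀ w N i → w · A i ≡ 0ℚ → onFace w N i ≡ ℤ.+ N
  onFace-on w N i on = cong (if_then ℤ.+ N else ℤ.+ 0) (dec-true (w · A i ≟ 0ℚ) on)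

  onFace-off : ∀ w N i → w · A i ≢ 0ℚ → onFace w N i ≡ ℤ.+ 0
  onFace-off w N i off = cong (if_then ℤ.+ N else ℤ.+ 0) (dec-false (w · A i ≟ 0ℚ) off)

  cone⇒face : PAdicGenCone p a → ∀ w → ValidIneq a w → PAdicGenSpan p a (Face w)
  cone⇒face cone-gen w w-valid x (λ′ , λ′-supp , λ′-rep) = λ″ , λ″-supp , λ″-padic , comb-unshift x t μ μ-rep
    where
    bound = uniform-bound (λ i K → - λ′ i ≤ ι (ℤ.+ K)) (λ i k≤l b → ≤-trans b (ι-ℕ-mono k≤l)) (archimedean ∘ -_ ∘ λ′)
    N = proj₁ bound
    t = onFace w N

    κ : Fin n → ℚ
    κ i = λ′ i + ι (t i)

    κ-supp : ∀ i → ¬ Face w i → κ i ≡ 0ℚ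
    κ-supp i ¬face = cong₂ _+_ (λ′-supp i ¬face) (cong ι (onFace-off w N i (¬Face⇒≢0 w i ¬face)))

    κ-nonNeg : ∀ i → 0ℚ ≤ κ i
    κ-nonNeg i = by-cases (w · A i ≟ 0ℚ)
      where
      by-cases : Dec (w · A i ≡ 0ℚ) → 0ℚ ≤ κ i
      by-cases (yes on) = ≤-trans (≤-trans (≤-reflexive (sym (+-inverseʳ (λ′ i)))) (+-monoʳ-≤ (λ′ i) (proj₂ bound i)))
                                  (≤-reflexive (cong (λ s → λ′ i + ι s) (sym (onFace-on w N i on))))
      by-cases (no off) = ≤-reflexive (sym (κ-supp i (λ face → off (proj₂ face))))

    y∈cone : InCone a (embed (shift x t))
    y∈cone = κ , κ-nonNeg , comb-shift x t λ′ λ′-rep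

    μ = proj₁ (cone-gen (shift x t) y∈cone)
    μ-nonNeg-padic = proj₁ (proj₂ (cone-gen (shift x t) y∈cone))
    μ-rep = proj₂ (proj₂ (cone-gen (shift x t) y∈cone))

    λ″ : Fin n → ℚ
    λ″ i = μ i - ι (t i)

    λ″-supp : ∀ i → ¬ Face w i → λ″ i ≡ 0ℚ
    λ″-supp i ¬face = cong₂ _-_
      (support⊆face A w (valid⇒ w w-valid) (proj₁ ∘ μ-nonNeg-padic) μ-rep
        (span-face-tight w κ-supp (comb-shift x t λ′ λ′-rep)) i off)
      (cong ι (onFace-off w N i off))
      where off = ¬Face⇒≢0 w i ¬face

    λ″-padic : ∀ i → IsPAdic p (λ″ i)
    λ″-padic i = padic-+ (proj₂ (μ-nonNeg-padic i)) (subst (IsPAdic p) (ι-neg (t i)) (padic-ι (ℤ.- t i)))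

  face⇒cone : (∀ w → ValidIneq a w → PAdicGenSpan p a (Face w)) → PAdicGenCone p a
  face⇒cone face-gen x x∈cone = λ″ , mix , lin-affine A γ λ₀ ν λ₀-rep (coeffs-rep c)
    where
    open Certificates A x∈cone
    open Certificate
    c = proj₁ interior-certificate
    interior = proj₂ interior-certificate
    W = normal c
    ν = coeffs c

    ν-supp : ∀ i → ¬ Face W i → ν i ≡ 0ℚ
    ν-supp i ¬face =
      support⊆face A W (normal-valid c) (coeffs-nonNeg c) (coeffs-rep c) (normal-tight c) i (¬Face⇒≢0 W i ¬face)

    span = face-gen W (⇒valid W (normal-valid c)) x (ν , ν-supp , coeffs-rep c)
    λ₀ = proj₁ span
    λ₀-supp = proj₁ (proj₂ span)
    λ₀-padic = proj₁ (proj₂ (proj₂ span))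
    λ₀-rep = proj₂ (proj₂ (proj₂ span))

    interior-or-off : ∀ i → 0ℚ < ν i ⊎ λ₀ i ≡ 0ℚ
    interior-or-off i = by-cases (W · A i ≟ 0ℚ)
      where
      by-cases : Dec (W · A i ≡ 0ℚ) → 0ℚ < ν i ⊎ λ₀ i ≡ 0ℚ
      by-cases (yes on) = inj₁ (interior i on)
      by-cases (no off) = inj₂ (λ₀-supp i (λ face → off (proj₂ face)))

    mixture = padic-mix ν λ₀ (coeffs-nonNeg c) λ₀-padic interior-or-off
    γ = proj₁ mixture
    mix = proj₂ mixture
    λ″ : Fin n → ℚ
    λ″ i = γ * λ₀ i + (1ℚ - γ) * ν i

theorem1p2 : (p : ℕ) → Prime p → (n m : ℕ) → (a : Fin n → Vecℤ m) →
    PAdicGenCone p a ⇔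
      ((w : Vecℚ m) → ValidIneq a w →
        PAdicGenSpan p a (λ i → InFace a w (embed (a i))))
theorem1p2 p p-prime n m a = mk⇔ cone⇒face face⇒cone
  where
  open Faces p (ℕ.nonTrivial⇒n>1 p {{prime⇒nonTrivial p-prime}}) a
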